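{- Let $\mathbb{P}$ and $\mathbb{Q}$ be directed quasi-orders, $n\in\omega$, $\lambda$ a cardinal, and suppose $\mathrm{PH}_n(\mathbb{P},\lambda)$ holds and $f:\mathbb{P}\to\mathbb{Q}$ is a monotone map (i.e. $p\le p'$ implies $f(p)\le f(p')$) whose image is cofinal in $\mathbb{Q}$. Then $\mathrm{PH}_n(\mathbb{Q},\lambda)$ holds.
   Context: For a directed quasi-order $(P,\le)$ and $m\ge1$: $P^{\le m}=\bigcup_{i=1}^mP^i$; $\mathbf{x}\trianglelefteq\mathbf{y}$ means $\mathbf{x}$ is obtained from $\mathbf{y}$ by deleting coordinates; $P\langle\langle m\rangle\rangle$ is the set of $\sigma=(\sigma(1),\dots,\sigma(m))$ with $\sigma(i)\in P^i$ and $\sigma(1)\trianglelefteq\cdots\trianglelefteq\sigma(m)$ ($P^1$ identified with $P$). $F:P^{\le m}\to P$ is $m$-cofinal if $x\le F(x)$ for $x\in P$ and $F(\mathbf{x})\le F(\mathbf{y})$ whenever $\mathbf{x}\trianglelefteq\mathbf{y}$; $F^*(\sigma)=(F(\sigma(1)),\dots,F(\sigma(m)))$. $\mathrm{PH}_n(P,\lambda)$: for every $c:P^{n+1}\to\lambda$ there is an $(n+1)$-cofinal $F:P^{\le n+1}\to P$ with $c\circ F^*$ constant. -}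

module Defs where

open import Data.Nat using (ℕ; zero; suc)
open import Data.Fin using (Fin; zero; suc; toℕ; inject₁)
open import Data.Vec using (Vec; []; _∷_; tabulate)
open import Data.Product using (Σ; ∃; _×_; _,_)
open import Relation.Binary.PropositionalEquality using (_≡_)
open import Relation.Binary.Structures using (IsPreorder)

record QuasiOrder : Set₁ where
  field
    Carrier    : Set
    _≤_        : Carrier → Carrier → Set
    isPreorder : IsPreorder _≡_ _≤_

record Directed (P : QuasiOrder) : Set where
  open QuasiOrder P
  field
    inhabited : Carrier
    upper     : ∀ x y → Σ Carrier λ z → (x ≤ z) × (y ≤ z)

data _⊴_ {A : Set} : ∀ {k l} → Vec A k → Vec A l → Set where
  []⊴  : [] ⊴ []
  skip : ∀ {k l} {xs : Vec A k} {ys : Vec A l} (y : A) → xs ⊴ ys → xs ⊴ (y ∷ ys)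
  keep : ∀ {k l} {xs : Vec A k} {ys : Vec A l} (x : A) → xs ⊴ ys → (x ∷ xs) ⊴ (x ∷ ys)

module _ (P : QuasiOrder) where
  open QuasiOrder P

  -- P^{≤ m} for m = suc n: a tuple of length i+1 for i : Fin (suc n).
  -- A map F : P^{≤ m} → P is given by its restrictions to each P^{i+1}.
  DomMap : ℕ → Set
  DomMap n = (i : Fin (suc n)) → Vec Carrier (suc (toℕ i)) → Carrier

  -- m-cofinal, with m = suc n  (P^1 identified with P via x ↦ [x]).
  IsCofinal : (n : ℕ) → DomMap n → Set
  IsCofinal n F =
    (∀ x → x ≤ F zero (x ∷ [])) ×
    (∀ (i j : Fin (suc n)) (x : Vec Carrier (suc (toℕ i))) (y : Vec Carrier (suc (toℕ j)))
       → x ⊴ y → F i x ≤ F j y)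

  -- P⟨⟨m⟩⟩ for m = suc n: σ(i+1) ∈ P^{i+1}, with σ(1) ⊴ σ(2) ⊴ … ⊴ σ(m).
  Chain : ℕ → Set
  Chain n = Σ ((i : Fin (suc n)) → Vec Carrier (suc (toℕ i)))
              λ σ → (i : Fin n) → σ (inject₁ i) ⊴ σ (suc i)

  star : (n : ℕ) → DomMap n → Chain n → Vec Carrier (suc n)
  star n F (σ , _) = tabulate (λ i → F i (σ i))

  -- PH_n(P, λ), with the cardinal λ represented by a set Λ of colours.
  PH : ℕ → Set → Set
  PH n Λ = (c : Vec Carrier (suc n) → Λ) →
    Σ (DomMap n) λ F → IsCofinal n F ×
      (∀ (σ τ : Chain n) → c (star n F σ) ≡ c (star n F τ))

Monotone : (P Q : QuasiOrder) → (QuasiOrder.Carrier P → QuasiOrder.Carrier Q) → Set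
Monotone P Q f = ∀ {p p'} → QuasiOrder._≤_ P p p' → QuasiOrder._≤_ Q (f p) (f p')

CofinalImage : (P Q : QuasiOrder) → (QuasiOrder.Carrier P → QuasiOrder.Carrier Q) → Set
CofinalImage P Q f = ∀ q → Σ (QuasiOrder.Carrier P) λ p → QuasiOrder._≤_ Q q (f p)

module Submission where

open import Defs
open import Data.Nat using (ℕ; suc)
open import Data.Fin using (zero)
open import Data.Vec using (Vec; []; _∷_; map)
open import Data.Vec.Properties using (tabulate-∘)
open import Data.Product using (Σ; _×_; _,_; proj₁; proj₂)
open import Relation.Binary.PropositionalEquality using (_≡_; cong; module ≡-Reasoning)
open import Relation.Binary.Structures using (IsPreorder)

-- Choose for each q ∈ Q some g(q) ∈ P with q ≤ f(g(q)).  A colouring c of Q^{n+1}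
-- pulls back to the colouring c ∘ map f of P^{n+1}; a homogeneous cofinal F for it
-- is pushed forward to the cofinal map f ∘ F ∘ map g on Q^{≤ n+1}, and since map g
-- sends Q-chains to P-chains, c ∘ (f ∘ F ∘ map g)* is constant.

map-⊴ : ∀ {A B : Set} (g : A → B) {k l} {xs : Vec A k} {ys : Vec A l} →
        xs ⊴ ys → map g xs ⊴ map g ys
map-⊴ g []⊴        = []⊴
map-⊴ g (skip y p) = skip (g y) (map-⊴ g p)
map-⊴ g (keep x p) = keep (g x) (map-⊴ g p)

module _ (P Q : QuasiOrder) (n : ℕ) where
  private
    module P = QuasiOrder P
    module Q = QuasiOrder Q

  map-Chain : (Q.Carrier → P.Carrier) → Chain Q n → Chain P n
  map-Chain g (σ , σ-⊴) = (λ i → map g (σ i)) , (λ i → map-⊴ g (σ-⊴ i))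

  conjugate : (P.Carrier → Q.Carrier) → (Q.Carrier → P.Carrier) → DomMap P n → DomMap Q n
  conjugate f g F i ys = f (F i (map g ys))

  star-conjugate : (f : P.Carrier → Q.Carrier) (g : Q.Carrier → P.Carrier)
                   (F : DomMap P n) (σ : Chain Q n) →
                   star Q n (conjugate f g F) σ ≡ map f (star P n F (map-Chain g σ))
  star-conjugate f g F (σ , _) = tabulate-∘ f (λ i → F i (map g (σ i)))

  conjugate-isCofinal : (f : P.Carrier → Q.Carrier) (g : Q.Carrier → P.Carrier) →
                        Monotone P Q f → (∀ q → q Q.≤ f (g q)) →
                        (F : DomMap P n) → IsCofinal P n F → IsCofinal Q n (conjugate f g F)
  conjugate-isCofinal f g f-mono q≤fgq F (F-above , F-mono) = above , mono
    where
    above : ∀ q → q Q.≤ conjugate f g F zero (q ∷ [])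
    above q = IsPreorder.trans Q.isPreorder (q≤fgq q) (f-mono (F-above (g q)))

    mono : ∀ i j xs ys → xs ⊴ ys → conjugate f g F i xs Q.≤ conjugate f g F j ys
    mono i j xs ys xs⊴ys = f-mono (F-mono i j (map g xs) (map g ys) (map-⊴ g xs⊴ys))

  conjugate-homogeneous : {Λ : Set} (c : Vec Q.Carrier (suc n) → Λ)
                          (f : P.Carrier → Q.Carrier) (g : Q.Carrier → P.Carrier) (F : DomMap P n) →
                          (∀ σ τ → c (map f (star P n F σ)) ≡ c (map f (star P n F τ))) →
                          ∀ σ τ → c (star Q n (conjugate f g F) σ) ≡ c (star Q n (conjugate f g F) τ)
  conjugate-homogeneous c f g F homogeneous σ τ = begin
    c (star Q n (conjugate f g F) σ)     ≡⟨ cong c (star-conjugate f g F σ) ⟩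
    c (map f (star P n F (map-Chain g σ))) ≡⟨ homogeneous (map-Chain g σ) (map-Chain g τ) ⟩
    c (map f (star P n F (map-Chain g τ))) ≡⟨ cong c (star-conjugate f g F τ) ⟨
    c (star Q n (conjugate f g F) τ)     ∎
    where open ≡-Reasoning

lemma8p1 : (P Q : QuasiOrder) → Directed P → Directed Q → (n : ℕ) → (Λ : Set) →
    PH P n Λ → (f : QuasiOrder.Carrier P → QuasiOrder.Carrier Q) →
    Monotone P Q f → CofinalImage P Q f → PH Q n Λ
lemma8p1 P Q _ _ n Λ ph f f-mono f-cofinal c =
  conjugate P Q n f g F ,
  conjugate-isCofinal P Q n f g f-mono (λ q → proj₂ (f-cofinal q)) F F-cofinal ,
  conjugate-homogeneous P Q n c f g F F-homogeneous
  where
  g : QuasiOrder.Carrier Q → QuasiOrder.Carrier P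
  g q = proj₁ (f-cofinal q)

  F : DomMap P n
  F = proj₁ (ph (λ xs → c (map f xs)))

  F-cofinal : IsCofinal P n F
  F-cofinal = proj₁ (proj₂ (ph (λ xs → c (map f xs))))

  F-homogeneous : ∀ σ τ → c (map f (star P n F σ)) ≡ c (map f (star P n F τ))
  F-homogeneous = proj₂ (proj₂ (ph (λ xs → c (map f xs))))
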